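{- For $p=100$, we have $$C_p(x,y)=\frac{1-2x-x^2y+x^3}{1-3x+x^2-x^2y+2x^3}.$$
   Context: A Catalan word of length $n\geq 1$ is a word $w_1\ldots w_n$ over the non-negative integers with $w_1=0$ and $0\leq w_i\leq w_{i-1}+1$ for $2\leq i\leq n$; the empty word is the unique Catalan word of length $0$. A word $w$ contains the pattern $p=p_1\ldots p_k$ if there are indices $i_1<\cdots<i_k$ such that $w_{i_1}\ldots w_{i_k}$ is order-isomorphic to $p$ (for all $a,b$: $w_{i_a}<w_{i_b}$ iff $p_a<p_b$, and $w_{i_a}=w_{i_b}$ iff $p_a=p_b$); otherwise $w$ avoids $p$. $\mathcal{C}_n(p)$ is the set of Catalan words of length $n$ avoiding $p$. A descent of $w$ is an index $i$ with $w_i>w_{i+1}$. $C_p(x,y)=\sum_{n,k\geq 0}c_{n,k}x^ny^k$, where $c_{n,k}$ is the number of words in $\mathcal{C}_n(p)$ with exactly $k$ descents. -}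

module Defs where

open import Data.Bool using (Bool; true; false; _∧_; not; if_then_else_)
open import Data.Nat using (ℕ; zero; suc; _+_; _∸_; _<ᵇ_; _≡ᵇ_; _≤ᵇ_)
open import Data.List using (List; []; _∷_; _++_; map; concatMap; upTo; filterᵇ; length; zip; foldr)
open import Data.Bool.ListAction using (any; all)
open import Data.Product using (_×_; _,_)
open import Data.Integer using (ℤ; +_; -_) renaming (_+_ to _+ℤ_; _*_ to _*ℤ_)

Word : Set
Word = List ℕ

_==ᵇ_ : Bool → Bool → Bool
true  ==ᵇ b = b
false ==ᵇ b = not b

catalanTail : ℕ → Word → Bool
catalanTail prev []       = true
catalanTail prev (y ∷ ys) = (y ≤ᵇ suc prev) ∧ catalanTail y ys

isCatalan : Word → Bool
isCatalan []       = true
isCatalan (x ∷ xs) = (x ≡ᵇ 0) ∧ catalanTail x xs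

wordsOf : ℕ → ℕ → List Word
wordsOf zero    b = [] ∷ []
wordsOf (suc n) b = concatMap (λ x → map (x ∷_) (wordsOf n b)) (upTo b)

-- All Catalan words of length n (their letters are < n when n ≥ 1).
catalanWords : ℕ → List Word
catalanWords n = filterᵇ isCatalan (wordsOf n n)

subseqs : Word → List Word
subseqs []       = [] ∷ []
subseqs (x ∷ xs) = map (x ∷_) (subseqs xs) ++ subseqs xs

orderIso : Word → Word → Bool
orderIso u p =
  (length u ≡ᵇ length p) ∧
  all (λ { (ua , pa) → all (λ { (ub , pb) →
          ((ua <ᵇ ub) ==ᵇ (pa <ᵇ pb)) ∧ ((ua ≡ᵇ ub) ==ᵇ (pa ≡ᵇ pb)) }) z }) z
  where z = zip u p

contains : Word → Word → Bool
contains w p = any (λ s → orderIso s p) (subseqs w)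

avoids : Word → Word → Bool
avoids w p = not (contains w p)

descents : Word → ℕ
descents []           = 0
descents (x ∷ [])     = 0
descents (x ∷ y ∷ ys) = (if y <ᵇ x then 1 else 0) + descents (y ∷ ys)

c : Word → ℕ → ℕ → ℕ
c p n k = length (filterᵇ (λ w → avoids w p ∧ (descents w ≡ᵇ k)) (catalanWords n))

-- Formal power series in x, y with integer coefficients:
-- F n k is the coefficient of xⁿ yᵏ.

FPS : Set
FPS = ℕ → ℕ → ℤ

sumℤ : List ℤ → ℤ
sumℤ = foldr _+ℤ_ (+ 0)

_⋆_ : FPS → FPS → FPS
(f ⋆ g) n k =
  sumℤ (concatMap (λ i → map (λ j → f i j *ℤ g (n ∸ i) (k ∸ j)) (upTo (suc k)))
                  (upTo (suc n)))

Cgf : Word → FPS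
Cgf p n k = + c p n k

p100 : Word
p100 = 1 ∷ 0 ∷ 0 ∷ []

numer : FPS
numer 0 0 = + 1
numer 1 0 = - (+ 2)
numer 2 1 = - (+ 1)
numer 3 0 = + 1
numer _ _ = + 0

denom : FPS
denom 0 0 = + 1
denom 1 0 = - (+ 3)
denom 2 0 = + 1
denom 2 1 = - (+ 1)
denom 3 0 = + 2
denom _ _ = + 0

-- A 100-avoiding Catalan word of length n + 1 is a 0 followed by a 100-avoiding "tail": a word
-- of length n that starts with 0 (an avoider itself) or with 1.  A tail starting with 1 either has
-- no 0, and is then an avoider shifted up by one, or has exactly one 0 (a second one would give
-- 1 0 0), which stands just before a 1 or at the end; deleting it and shifting down leaves an
-- avoider of length n − 1.  So the avoiders are generated by shifting and by inserting a single
-- 0, and an inserted 0 raises the descent number by one or not according to the letter before it.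
-- Following the descents through this decomposition gives four linear recurrences, and
-- eliminating the auxiliary counts leaves, for every n and k,
--   c(n+4,k) − 3 c(n+3,k) + c(n+2,k) − c(n+2,k−1) + 2 c(n+1,k) = 0,
-- i.e. C_100 · (1 − 3x + x² − x²y + 2x³) has no term of x-degree ≥ 4; the lower terms are
-- finite computations.
module Submission where

open import Defs
open import Data.Bool using (Bool; true; false; _∧_; _∨_; not; T; if_then_else_)
open import Data.Bool.Properties
  using (∧-zeroʳ; ∨-zeroʳ; ∨-identityʳ; ∨-assoc; ∧-distribˡ-∨; T-≡; not-injective)
open import Data.Bool.ListAction using (any; or)
open import Data.Nat using (ℕ; zero; suc; _+_; _*_; _∸_; _<ᵇ_; _≡ᵇ_; _≤ᵇ_; _<_; _≤_; s≤s; z≤n)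
import Data.Nat.Properties as ℕ
open import Data.Nat.ListAction using (sum)
open import Data.Nat.ListAction.Properties using (sum-++)
open import Data.Nat.Tactic.RingSolver using (solve-∀)
open import Data.Integer using (ℤ; +_; -_) renaming (_+_ to _+ℤ_; _*_ to _*ℤ_; _-_ to _-ℤ_)
import Data.Integer.Properties as ℤ
open import Data.Integer.Tactic.RingSolver using () renaming (solve-∀ to ℤ-solve-∀)
open import Data.List using (List; []; _∷_; _++_; [_]; map; concatMap; length; filterᵇ; upTo)
open import Data.List.Properties
  using (map-++; map-∘; map-cong; map-cong-local; length-map; length-++; ∷-injectiveʳ; upTo-∷ʳ)
open import Data.List.Membership.Propositional using (_∈_; find; lose)
open import Data.List.Membership.Propositional.Properties
  using (∈-map⁺; ∈-map⁻; ∈-++⁺ˡ; ∈-++⁺ʳ; ∈-++⁻; ∈-∃++; ∈-concatMap⁺; ∈-concatMap⁻; ∈-upTo⁺; ∈-filter⁺; ∈-filter⁻)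
open import Data.List.Relation.Unary.Any using (here; there)
open import Data.List.Relation.Unary.All as All using (All; []; _∷_)
open import Data.List.Relation.Unary.All.Properties
  using () renaming (map⁺ to All-map⁺; ++⁺ to All-++⁺; concat⁺ to All-concat⁺)
open import Data.List.Relation.Unary.AllPairs using ([]; _∷_)
open import Data.List.Relation.Unary.Unique.Propositional using (Unique)
open import Data.List.Relation.Unary.Unique.Propositional.Properties using (++⁺; map⁺; filter⁺; upTo⁺)
open import Data.Product using (_×_; _,_; ∃; ∃₂; proj₁; proj₂)
open import Data.Sum using (_⊎_; inj₁; inj₂)
open import Data.Empty using (⊥-elim)
open import Function using (_∘_; Equivalence)
open import Relation.Nullary using (¬_)
open import Relation.Nullary.Decidable using (T?)
open import Relation.Binary.PropositionalEquality hiding ([_])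

variable
  A B : Set

𝟙 : Bool → ℕ
𝟙 true  = 1
𝟙 false = 0

total : (A → ℕ) → List A → ℕ
total f xs = sum (map f xs)

total-++ : (f : A → ℕ) (xs ys : List A) → total f (xs ++ ys) ≡ total f xs + total f ys
total-++ f xs ys = trans (cong sum (map-++ f xs ys)) (sum-++ (map f xs) (map f ys))

total-map : (f : B → ℕ) (g : A → B) (xs : List A) → total f (map g xs) ≡ total (f ∘ g) xs
total-map f g xs = cong sum (sym (map-∘ xs))

total-cong : {f g : A → ℕ} → (∀ x → f x ≡ g x) → (xs : List A) → total f xs ≡ total g xs
total-cong f≗g xs = cong sum (map-cong f≗g xs)

total-cong-All : {f g : A → ℕ} {xs : List A} → All (λ x → f x ≡ g x) xs → total f xs ≡ total g xs
total-cong-All f≗g = cong sum (map-cong-local f≗g)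

total-unit-weight : (w g : A → ℕ) {xs : List A} → All (λ x → w x ≡ 1) xs →
                    total (λ x → w x * g x) xs ≡ total g xs
total-unit-weight w g w≡1 =
  total-cong-All (All.map (λ {x} wx≡1 → trans (cong (_* g x) wx≡1) (ℕ.*-identityˡ (g x))) w≡1)

total-concatMap : (f : B → ℕ) (g : A → List B) (xs : List A) →
                  total f (concatMap g xs) ≡ total (total f ∘ g) xs
total-concatMap f g []       = refl
total-concatMap f g (x ∷ xs) =
  trans (total-++ f (g x) (concatMap g xs)) (cong (_+_ (total f (g x))) (total-concatMap f g xs))

total-+ : (f g : A → ℕ) (xs : List A) → total (λ x → f x + g x) xs ≡ total f xs + total g xs
total-+ f g []       = refl
total-+ f g (x ∷ xs) rewrite total-+ f g xs = interchange (f x) (g x) (total f xs) (total g xs)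
  where
  interchange : ∀ a b c d → (a + b) + (c + d) ≡ (a + c) + (b + d)
  interchange = solve-∀

total-zero : (xs : List A) → total (λ _ → 0) xs ≡ 0
total-zero []       = refl
total-zero (x ∷ xs) = total-zero xs

total-𝟙 : (p : A → Bool) (xs : List A) → total (𝟙 ∘ p) xs ≡ length (filterᵇ p xs)
total-𝟙 p []       = refl
total-𝟙 p (x ∷ xs) with p x
... | true  = cong suc (total-𝟙 p xs)
... | false = total-𝟙 p xs

∈-concatMap-find : (f : A → List B) (xs : List A) {z : B} →
                   z ∈ concatMap f xs → ∃ λ x → x ∈ xs × z ∈ f x
∈-concatMap-find f xs = find ∘ ∈-concatMap⁻ f {xs = xs}

∈-concatMap-lose : (f : A → List B) {xs : List A} {x : A} {z : B} →
                   x ∈ xs → z ∈ f x → z ∈ concatMap f xs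
∈-concatMap-lose f x∈xs z∈fx = ∈-concatMap⁺ f (lose x∈xs z∈fx)

Unique-concatMap⁺ : (f : A → List B) (g : B → A) {xs : List A} → Unique xs →
                    (∀ x → Unique (f x)) → (∀ x {z} → z ∈ f x → g z ≡ x) →
                    Unique (concatMap f xs)
Unique-concatMap⁺ f g {[]}     _            _     _     = []
Unique-concatMap⁺ f g {x ∷ xs} (x∉xs ∷ uxs) uniqF fibre =
  ++⁺ (uniqF x) (Unique-concatMap⁺ f g uxs uniqF fibre) disjoint
  where
  disjoint : ∀ {z} → ¬ (z ∈ f x × z ∈ concatMap f xs)
  disjoint (z∈fx , z∈rest) with ∈-concatMap-find f xs z∈rest
  ... | y , y∈xs , z∈fy = All.lookup x∉xs y∈xs (trans (sym (fibre x z∈fx)) (fibre y z∈fy))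

Unique⇒length≤ : (xs ys : List A) → Unique xs → (∀ {z} → z ∈ xs → z ∈ ys) → length xs ≤ length ys
Unique⇒length≤ []       ys _            _   = z≤n
Unique⇒length≤ (x ∷ xs) ys (x∉xs ∷ uxs) sub with ∈-∃++ (sub (here refl))
... | ys₁ , ys₂ , refl = begin
  suc (length xs)                   ≤⟨ s≤s (Unique⇒length≤ xs (ys₁ ++ ys₂) uxs sub′) ⟩
  suc (length (ys₁ ++ ys₂))         ≡⟨ cong suc (length-++ ys₁) ⟩
  suc (length ys₁ + length ys₂)     ≡⟨ ℕ.+-suc (length ys₁) (length ys₂) ⟨
  length ys₁ + length (x ∷ ys₂)     ≡⟨ length-++ ys₁ ⟨
  length (ys₁ ++ x ∷ ys₂)           ∎
  where
  open ℕ.≤-Reasoning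
  sub′ : ∀ {z} → z ∈ xs → z ∈ ys₁ ++ ys₂
  sub′ z∈xs with ∈-++⁻ ys₁ (sub (there z∈xs))
  ... | inj₁ z∈ys₁          = ∈-++⁺ˡ z∈ys₁
  ... | inj₂ (here refl)    = ⊥-elim (All.lookup x∉xs z∈xs refl)
  ... | inj₂ (there z∈ys₂) = ∈-++⁺ʳ ys₁ z∈ys₂

Unique⇒length≡ : (xs ys : List A) → Unique xs → Unique ys →
                 (∀ {z} → z ∈ xs → z ∈ ys) → (∀ {z} → z ∈ ys → z ∈ xs) → length xs ≡ length ys
Unique⇒length≡ xs ys uxs uys xs⊆ys ys⊆xs =
  ℕ.≤-antisym (Unique⇒length≤ xs ys uxs xs⊆ys) (Unique⇒length≤ ys xs uys ys⊆xs)

∧-true : ∀ {a b} → a ∧ b ≡ true → a ≡ true × b ≡ true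
∧-true {true} {true} _ = refl , refl

∨-false : ∀ {a b} → a ∨ b ≡ false → a ≡ false × b ≡ false
∨-false {false} {false} _ = refl , refl

toT : ∀ {b} → b ≡ true → T b
toT = Equivalence.from T-≡

fromT : ∀ {b} → T b → b ≡ true
fromT = Equivalence.to T-≡

<ᵇ-irrefl : ∀ x → (x <ᵇ x) ≡ false
<ᵇ-irrefl zero    = refl
<ᵇ-irrefl (suc x) = <ᵇ-irrefl x

≡ᵇ-refl : ∀ x → (x ≡ᵇ x) ≡ true
≡ᵇ-refl zero    = refl
≡ᵇ-refl (suc x) = ≡ᵇ-refl x

any-++ : (f : A → Bool) (xs ys : List A) → any f (xs ++ ys) ≡ any f xs ∨ any f ys
any-++ f []       ys = refl
any-++ f (x ∷ xs) ys = trans (cong (f x ∨_) (any-++ f xs ys)) (sym (∨-assoc (f x) (any f xs) (any f ys)))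

any-map : (f : B → Bool) (g : A → B) (xs : List A) → any f (map g xs) ≡ any (f ∘ g) xs
any-map f g xs = cong or (sym (map-∘ xs))

any-cong : {f g : A → Bool} → (∀ x → f x ≡ g x) → (xs : List A) → any f xs ≡ any g xs
any-cong f≗g xs = cong or (map-cong f≗g xs)

-- Occurrences of 100

occurs : ℕ → Word → Bool
occurs y []       = false
occurs y (z ∷ zs) = (y ≡ᵇ z) ∨ occurs y zs

repeatedBelow : ℕ → Word → Bool
repeatedBelow x []       = false
repeatedBelow x (y ∷ ys) = ((y <ᵇ x) ∧ occurs y ys) ∨ repeatedBelow x ys

has100 : Word → Bool
has100 []       = false
has100 (x ∷ xs) = repeatedBelow x xs ∨ has100 xs

is100 : Word → Bool
is100 (x ∷ y ∷ z ∷ []) = (y <ᵇ x) ∧ (y ≡ᵇ z)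
is100 _                = false

orderIso-100 : ∀ s → orderIso s p100 ≡ is100 s
orderIso-100 []                          = refl
orderIso-100 (x ∷ [])                    = refl
orderIso-100 (x ∷ y ∷ [])                = refl
orderIso-100 (x ∷ y ∷ z ∷ w ∷ s)         = refl
orderIso-100 (suc x ∷ suc y ∷ suc z ∷ []) = orderIso-100 (x ∷ y ∷ z ∷ [])
orderIso-100 (zero ∷ zero ∷ z ∷ [])      = refl
orderIso-100 (zero ∷ suc y ∷ z ∷ [])     = refl
orderIso-100 (suc x ∷ zero ∷ zero ∷ []) rewrite <ᵇ-irrefl x | ≡ᵇ-refl x = refl
orderIso-100 (suc x ∷ zero ∷ suc z ∷ []) rewrite <ᵇ-irrefl x | ≡ᵇ-refl x = ∧-zeroʳ _
orderIso-100 (suc x ∷ suc y ∷ zero ∷ [])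
  rewrite <ᵇ-irrefl x | ≡ᵇ-refl x | <ᵇ-irrefl y | ≡ᵇ-refl y | ∧-zeroʳ (y <ᵇ x) =
  trans (cong (xy-clause ∧_) (∧-zeroʳ _)) (∧-zeroʳ xy-clause)
  where xy-clause = (((x <ᵇ y) ==ᵇ false) ∧ ((x ≡ᵇ y) ==ᵇ false)) ∧ true

any-subseqs-cons : (f : Word → Bool) (x : ℕ) (xs : Word) →
                   any f (subseqs (x ∷ xs)) ≡ any (f ∘ (x ∷_)) (subseqs xs) ∨ any f (subseqs xs)
any-subseqs-cons f x xs =
  trans (any-++ f (map (x ∷_) (subseqs xs)) (subseqs xs)) (cong (_∨ _) (any-map f (x ∷_) (subseqs xs)))

any-is100-suffix : ∀ x y z zs → any (λ s → is100 (x ∷ y ∷ z ∷ s)) (subseqs zs) ≡ (y <ᵇ x) ∧ (y ≡ᵇ z)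
any-is100-suffix x y z []        = ∨-identityʳ _
any-is100-suffix x y z (z′ ∷ zs) =
  trans (any-subseqs-cons (λ s → is100 (x ∷ y ∷ z ∷ s)) z′ zs)
        (trans (cong (_∨ any (λ s → is100 (x ∷ y ∷ z ∷ s)) (subseqs zs)) (any-false (subseqs zs)))
               (any-is100-suffix x y z zs))
  where
  any-false : (ss : List Word) → any (λ _ → false) ss ≡ false
  any-false []       = refl
  any-false (_ ∷ ss) = any-false ss

any-is100-pair : ∀ x y ys → any (λ s → is100 (x ∷ y ∷ s)) (subseqs ys) ≡ (y <ᵇ x) ∧ occurs y ys
any-is100-pair x y []       = sym (∧-zeroʳ (y <ᵇ x))
any-is100-pair x y (z ∷ zs) =
  trans (any-subseqs-cons (λ s → is100 (x ∷ y ∷ s)) z zs)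
        (trans (cong₂ _∨_ (any-is100-suffix x y z zs) (any-is100-pair x y zs))
               (sym (∧-distribˡ-∨ (y <ᵇ x) (y ≡ᵇ z) (occurs y zs))))

any-is100-head : ∀ x ys → any (λ s → is100 (x ∷ s)) (subseqs ys) ≡ repeatedBelow x ys
any-is100-head x []       = refl
any-is100-head x (y ∷ ys) =
  trans (any-subseqs-cons (λ s → is100 (x ∷ s)) y ys)
        (cong₂ _∨_ (any-is100-pair x y ys) (any-is100-head x ys))

contains-100 : ∀ w → contains w p100 ≡ has100 w
contains-100 w = trans (any-cong orderIso-100 (subseqs w)) (any-is100 w)
  where
  any-is100 : ∀ w → any is100 (subseqs w) ≡ has100 w
  any-is100 []       = refl
  any-is100 (x ∷ xs) =
    trans (any-subseqs-cons is100 x xs) (cong₂ _∨_ (any-is100-head x xs) (any-is100 xs))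

-- Shifting and inserting zeros

shift : Word → Word
shift = map suc

unshift : Word → Word
unshift []           = []
unshift (zero ∷ ys)  = unshift ys
unshift (suc y ∷ ys) = y ∷ unshift ys

-- The words obtained from shift ys by inserting a 0 just before some 1 or at the end;
-- insertZero⁺ excludes the slot in front.
insertZero : Word → List Word
insertZero []           = [ 0 ∷ [] ]
insertZero (zero ∷ ys)  = (0 ∷ 1 ∷ shift ys) ∷ map (1 ∷_) (insertZero ys)
insertZero (suc y ∷ ys) = map (suc (suc y) ∷_) (insertZero ys)

insertZero⁺ : Word → List Word
insertZero⁺ []       = []
insertZero⁺ (x ∷ xs) = map (suc x ∷_) (insertZero xs)

occurs-++ : ∀ y xs ys → occurs y (xs ++ ys) ≡ occurs y xs ∨ occurs y ys
occurs-++ y []       ys = refl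
occurs-++ y (x ∷ xs) ys =
  trans (cong ((y ≡ᵇ x) ∨_) (occurs-++ y xs ys)) (sym (∨-assoc (y ≡ᵇ x) (occurs y xs) (occurs y ys)))

occurs-shift : ∀ y ys → occurs (suc y) (shift ys) ≡ occurs y ys
occurs-shift y []       = refl
occurs-shift y (z ∷ zs) = cong ((y ≡ᵇ z) ∨_) (occurs-shift y zs)

occurs-0-shift : ∀ ys → occurs 0 (shift ys) ≡ false
occurs-0-shift []       = refl
occurs-0-shift (y ∷ ys) = occurs-0-shift ys

shift-unshift : ∀ w → occurs 0 w ≡ false → shift (unshift w) ≡ w
shift-unshift []          _  = refl
shift-unshift (suc x ∷ w) w₀ = cong (suc x ∷_) (shift-unshift w w₀)

unshift-shift : ∀ ys → unshift (shift ys) ≡ ys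
unshift-shift []       = refl
unshift-shift (y ∷ ys) = cong (y ∷_) (unshift-shift ys)

length-unshift : ∀ w → occurs 0 w ≡ false → length (unshift w) ≡ length w
length-unshift w w₀ = trans (sym (length-map suc (unshift w))) (cong length (shift-unshift w w₀))

repeatedBelow-shift : ∀ x ys → repeatedBelow (suc x) (shift ys) ≡ repeatedBelow x ys
repeatedBelow-shift x []       = refl
repeatedBelow-shift x (y ∷ ys) =
  cong₂ (λ a b → ((y <ᵇ x) ∧ a) ∨ b) (occurs-shift y ys) (repeatedBelow-shift x ys)

has100-shift : ∀ w → has100 (shift w) ≡ has100 w
has100-shift []       = refl
has100-shift (x ∷ xs) = cong₂ _∨_ (repeatedBelow-shift x xs) (has100-shift xs)

has100-0∷ : ∀ w → has100 (0 ∷ w) ≡ has100 w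
has100-0∷ w = cong (_∨ has100 w) (nothing-below-0 w)
  where
  nothing-below-0 : ∀ w → repeatedBelow 0 w ≡ false
  nothing-below-0 []       = refl
  nothing-below-0 (y ∷ ys) = nothing-below-0 ys

-- A unique 0 can play neither the 1 of a 100 (nothing lies below it) nor a 0 (it is not repeated).
has100-delete0 : ∀ ps v → occurs 0 (ps ++ v) ≡ false → has100 (ps ++ 0 ∷ v) ≡ has100 (ps ++ v)
has100-delete0 []          v _   = has100-0∷ v
has100-delete0 (suc p ∷ ps) v ps₀ =
  cong₂ _∨_ (repeatedBelow-delete0 (suc p) ps ps₀) (has100-delete0 ps v ps₀)
  where
  occurs-delete0 : ∀ q ps → occurs (suc q) (ps ++ 0 ∷ v) ≡ occurs (suc q) (ps ++ v)
  occurs-delete0 q []       = refl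
  occurs-delete0 q (p ∷ ps) = cong ((suc q ≡ᵇ p) ∨_) (occurs-delete0 q ps)
  repeatedBelow-delete0 : ∀ x ps → occurs 0 (ps ++ v) ≡ false →
                          repeatedBelow x (ps ++ 0 ∷ v) ≡ repeatedBelow x (ps ++ v)
  repeatedBelow-delete0 x []          v₀ rewrite v₀ = cong (_∨ repeatedBelow x v) (∧-zeroʳ (0 <ᵇ x))
  repeatedBelow-delete0 x (suc p ∷ ps) ps₀ =
    cong₂ (λ a b → ((suc p <ᵇ x) ∧ a) ∨ b) (occurs-delete0 p ps) (repeatedBelow-delete0 x ps ps₀)

repeatedBelow-hit : ∀ x ps y v → (y <ᵇ x) ≡ true → occurs y v ≡ true → repeatedBelow x (ps ++ y ∷ v) ≡ true
repeatedBelow-hit x []       y v y<x y∈v rewrite y<x | y∈v = refl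
repeatedBelow-hit x (p ∷ ps) y v y<x y∈v rewrite repeatedBelow-hit x ps y v y<x y∈v = ∨-zeroʳ _

catalanTail-shift : ∀ p ys → catalanTail (suc p) (shift ys) ≡ catalanTail p ys
catalanTail-shift p []           = refl
catalanTail-shift p (zero ∷ ys)  = catalanTail-shift 0 ys
catalanTail-shift p (suc y ∷ ys) = cong ((y <ᵇ suc p) ∧_) (catalanTail-shift (suc y) ys)

catalanTail-0 : ∀ w → isCatalan w ≡ true → catalanTail 0 w ≡ true
catalanTail-0 []          _ = refl
catalanTail-0 (zero ∷ w) cw = cw

catalanTail-shift-catalan : ∀ w → isCatalan w ≡ true → catalanTail 0 (shift w) ≡ true
catalanTail-shift-catalan []         _  = refl
catalanTail-shift-catalan (zero ∷ w) cw = trans (catalanTail-shift 0 w) cw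

catalanTail-weaken : ∀ q v → catalanTail 0 v ≡ true → catalanTail q v ≡ true
catalanTail-weaken q []               _  = refl
catalanTail-weaken q (zero ∷ v)       cv = cv
catalanTail-weaken q (suc zero ∷ v)   cv = cv

catalanTail-suffix : ∀ q ps y v → catalanTail q (ps ++ y ∷ v) ≡ true → catalanTail y v ≡ true
catalanTail-suffix q []       y v ct = proj₂ (∧-true {y ≤ᵇ suc q} ct)
catalanTail-suffix q (p ∷ ps) y v ct = catalanTail-suffix p ps y v (proj₂ (∧-true {p ≤ᵇ suc q} ct))

catalanTail-delete0 : ∀ q ps v → catalanTail q (ps ++ 0 ∷ v) ≡ true → catalanTail q (ps ++ v) ≡ true
catalanTail-delete0 q []       v ct = catalanTail-weaken q v ct
catalanTail-delete0 q (p ∷ ps) v ct with ∧-true {p ≤ᵇ suc q} ct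
... | p≤q+1 , ct′ rewrite p≤q+1 = catalanTail-delete0 p ps v ct′

starts-with-1 : ∀ v → catalanTail 0 v ≡ true → occurs 0 v ≡ false → v ≡ [] ⊎ ∃ λ v′ → v ≡ 1 ∷ v′
starts-with-1 []             _ _ = inj₁ refl
starts-with-1 (suc zero ∷ v) _ _ = inj₂ (v , refl)

first-zero : ∀ w → occurs 0 w ≡ false ⊎ ∃₂ λ ps v → w ≡ ps ++ 0 ∷ v × occurs 0 ps ≡ false
first-zero []          = inj₁ refl
first-zero (zero ∷ w)  = inj₂ ([] , w , refl , refl)
first-zero (suc x ∷ w) with first-zero w
... | inj₁ w₀                    = inj₁ w₀
... | inj₂ (ps , v , refl , ps₀) = inj₂ (suc x ∷ ps , v , refl , ps₀)

insertZero-split : ∀ ys {t} → t ∈ insertZero ys → ∃₂ λ ps v → t ≡ ps ++ 0 ∷ v × ps ++ v ≡ shift ys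
insertZero-split []            (here refl) = [] , [] , refl , refl
insertZero-split (zero ∷ ys)   (here refl) = [] , 1 ∷ shift ys , refl , refl
insertZero-split (zero ∷ ys)   (there t∈)  with ∈-map⁻ (1 ∷_) t∈
... | t′ , t′∈ , refl with insertZero-split ys t′∈
... | ps , v , refl , ps++v = 1 ∷ ps , v , refl , cong (1 ∷_) ps++v
insertZero-split (suc y ∷ ys)  t∈          with ∈-map⁻ (suc (suc y) ∷_) t∈
... | t′ , t′∈ , refl with insertZero-split ys t′∈
... | ps , v , refl , ps++v = suc (suc y) ∷ ps , v , refl , cong (suc (suc y) ∷_) ps++v

insertZero-catalanTail : ∀ p ys {t} → catalanTail p ys ≡ true → t ∈ insertZero ys →
                         catalanTail (suc p) t ≡ true
insertZero-catalanTail p []           _  (here refl) = refl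
insertZero-catalanTail p (zero ∷ ys)  ct (here refl) = trans (catalanTail-shift 0 ys) ct
insertZero-catalanTail p (zero ∷ ys)  ct (there t∈) with ∈-map⁻ (1 ∷_) t∈
... | t′ , t′∈ , refl = insertZero-catalanTail 0 ys ct t′∈
insertZero-catalanTail p (suc y ∷ ys) ct t∈ with ∈-map⁻ (suc (suc y) ∷_) t∈ | ∧-true {y <ᵇ suc p} ct
... | t′ , t′∈ , refl | y≤p , ct′ rewrite y≤p = insertZero-catalanTail (suc y) ys ct′ t′∈

insertZero-complete : ∀ ps v → occurs 0 ps ≡ false → occurs 0 v ≡ false → (v ≡ [] ⊎ ∃ λ v′ → v ≡ 1 ∷ v′) →
                      ps ++ 0 ∷ v ∈ insertZero (unshift (ps ++ v))
insertZero-complete []                 .[]        _   _  (inj₁ refl)        = here refl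
insertZero-complete []                 .(1 ∷ v′) _   v₀ (inj₂ (v′ , refl)) =
  here (cong (λ u → 0 ∷ 1 ∷ u) (sym (shift-unshift v′ v₀)))
insertZero-complete (suc zero ∷ ps)    v          ps₀ v₀ v₁ =
  there (∈-map⁺ (1 ∷_) (insertZero-complete ps v ps₀ v₀ v₁))
insertZero-complete (suc (suc p) ∷ ps) v          ps₀ v₀ v₁ =
  ∈-map⁺ (suc (suc p) ∷_) (insertZero-complete ps v ps₀ v₀ v₁)

length-insert : ∀ (ps : Word) y v → length (ps ++ y ∷ v) ≡ suc (length (ps ++ v))
length-insert []       y v = refl
length-insert (p ∷ ps) y v = cong suc (length-insert ps y v)

unshift-delete0 : ∀ ps v → unshift (ps ++ 0 ∷ v) ≡ unshift (ps ++ v)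
unshift-delete0 []           v = refl
unshift-delete0 (zero ∷ ps)  v = unshift-delete0 ps v
unshift-delete0 (suc p ∷ ps) v = cong (p ∷_) (unshift-delete0 ps v)

insertZero-length : ∀ ys {t} → t ∈ insertZero ys → length t ≡ suc (length ys)
insertZero-length ys t∈ with insertZero-split ys t∈
... | ps , v , refl , ps++v =
  trans (length-insert ps 0 v) (cong suc (trans (cong length ps++v) (length-map suc ys)))

insertZero-unshift : ∀ ys {t} → t ∈ insertZero ys → unshift t ≡ ys
insertZero-unshift ys t∈ with insertZero-split ys t∈
... | ps , v , refl , ps++v = trans (unshift-delete0 ps v) (trans (cong unshift ps++v) (unshift-shift ys))

insertZero-occurs0 : ∀ ys {t} → t ∈ insertZero ys → occurs 0 t ≡ true
insertZero-occurs0 ys t∈ with insertZero-split ys t∈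
... | ps , v , refl , _ = trans (occurs-++ 0 ps (0 ∷ v)) (∨-zeroʳ (occurs 0 ps))

-- The avoiders of length n, and the 100-avoiding words of length n that start with 1 and
-- may follow a leading 0 in a Catalan word.
mutual
  avoiders : ℕ → List Word
  avoiders zero    = [ [] ]
  avoiders (suc n) = map (0 ∷_) (avoiders n ++ avoiders₁ n)

  avoiders₁ : ℕ → List Word
  avoiders₁ zero    = []
  avoiders₁ (suc m) = map shift (avoiders (suc m)) ++ concatMap insertZero⁺ (avoiders m)

insertZero⁺-avoider : ∀ V {t} → isCatalan V ≡ true → has100 V ≡ false → t ∈ insertZero⁺ V →
                      catalanTail 0 t ≡ true × has100 t ≡ false × length t ≡ suc (length V)
insertZero⁺-avoider (zero ∷ xs) cV hV t∈ with ∈-map⁻ (1 ∷_) t∈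
... | t′ , t′∈ , refl with insertZero-split xs t′∈
... | ps , v , refl , ps++v =
  insertZero-catalanTail 0 xs cV t′∈ ,
  trans (has100-delete0 (1 ∷ ps) v (trans (cong (occurs 0) ps++v) (occurs-0-shift xs)))
        (trans (cong (has100 ∘ (1 ∷_)) ps++v) (trans (has100-shift (0 ∷ xs)) hV)) ,
  cong suc (insertZero-length xs t′∈)

mutual
  avoiders-sound : ∀ n {w} → w ∈ avoiders n → isCatalan w ≡ true × has100 w ≡ false × length w ≡ n
  avoiders-sound zero    (here refl) = refl , refl , refl
  avoiders-sound (suc n) w∈ with ∈-map⁻ (0 ∷_) w∈
  ... | z , z∈ , refl with ∈-++⁻ (avoiders n) z∈
  ... | inj₁ z∈S with avoiders-sound n z∈S
  ...   | cz , hz , lz = catalanTail-0 z cz , trans (has100-0∷ z) hz , cong suc lz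
  avoiders-sound (suc n) w∈ | z , z∈ , refl | inj₂ z∈U with avoiders₁-sound n z∈U
  ...   | cz , hz , lz = cz , trans (has100-0∷ z) hz , cong suc lz

  avoiders₁-sound : ∀ n {z} → z ∈ avoiders₁ n → catalanTail 0 z ≡ true × has100 z ≡ false × length z ≡ n
  avoiders₁-sound (suc m) z∈ with ∈-++⁻ (map shift (avoiders (suc m))) z∈
  ... | inj₁ z∈shifts with ∈-map⁻ shift z∈shifts
  ...   | V , V∈ , refl with avoiders-sound (suc m) V∈
  ...     | cV , hV , lV =
    catalanTail-shift-catalan V cV , trans (has100-shift V) hV , trans (length-map suc V) lV
  avoiders₁-sound (suc m) z∈ | inj₂ z∈ins with ∈-concatMap-find insertZero⁺ (avoiders m) z∈ins
  ... | V , V∈ , z∈V with avoiders-sound m V∈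
  ...   | cV , hV , lV with insertZero⁺-avoider V cV hV z∈V
  ...     | cz , hz , lz = cz , hz , trans lz (cong suc lV)

unshift-avoider : ∀ u → occurs 0 u ≡ false → catalanTail 0 (1 ∷ u) ≡ true → has100 (1 ∷ u) ≡ false →
                  isCatalan (0 ∷ unshift u) ≡ true × has100 (0 ∷ unshift u) ≡ false
unshift-avoider u u₀ cu hu =
  trans (sym (catalanTail-shift 0 (unshift u))) (trans (cong (catalanTail 1) (shift-unshift u u₀)) cu) ,
  trans (sym (has100-shift (0 ∷ unshift u))) (trans (cong (has100 ∘ (1 ∷_)) (shift-unshift u u₀)) hu)

mutual
  avoiders-complete : ∀ n w → length w ≡ n → isCatalan w ≡ true → has100 w ≡ false → w ∈ avoiders n
  avoiders-complete zero    []         _   _  _  = here refl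
  avoiders-complete (suc n) (zero ∷ z) len cw hw =
    ∈-map⁺ (0 ∷_) (tails-complete n z (ℕ.suc-injective len) cw (trans (sym (has100-0∷ z)) hw))

  tails-complete : ∀ n z → length z ≡ n → catalanTail 0 z ≡ true → has100 z ≡ false →
                   z ∈ avoiders n ++ avoiders₁ n
  tails-complete .0 []           refl _  _  = here refl
  tails-complete n  (zero ∷ z)   len  cz hz = ∈-++⁺ˡ (avoiders-complete n (0 ∷ z) len cz hz)
  tails-complete n  (suc y ∷ z)  len  cz hz = ∈-++⁺ʳ (avoiders n) (avoiders₁-complete n y z len cz hz)

  avoiders₁-complete : ∀ n y z → length (suc y ∷ z) ≡ n → catalanTail 0 (suc y ∷ z) ≡ true →
                       has100 (suc y ∷ z) ≡ false → suc y ∷ z ∈ avoiders₁ n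
  avoiders₁-complete (suc m) zero z len cz hz = ones-complete (suc m) z len cz hz (first-zero z)

  ones-complete : ∀ n z → length (1 ∷ z) ≡ n → catalanTail 0 (1 ∷ z) ≡ true → has100 (1 ∷ z) ≡ false →
                  occurs 0 z ≡ false ⊎ (∃₂ λ ps v → z ≡ ps ++ 0 ∷ v × occurs 0 ps ≡ false) →
                  1 ∷ z ∈ avoiders₁ n
  ones-complete (suc m) z len cz hz (inj₁ z₀) =
    ∈-++⁺ˡ (subst (_∈ map shift (avoiders (suc m))) (cong (1 ∷_) (shift-unshift z z₀))
             (∈-map⁺ shift (avoiders-complete (suc m) (0 ∷ unshift z) (trans (cong suc (length-unshift z z₀)) len)
                                              (proj₁ V-avoids) (proj₂ V-avoids))))
    where
    V-avoids = unshift-avoider z z₀ cz hz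
  ones-complete (suc m) .(ps ++ 0 ∷ v) len cz hz (inj₂ (ps , v , refl , ps₀)) =
    ∈-++⁺ʳ (map shift (avoiders (suc m)))
      (∈-concatMap-lose insertZero⁺
        (avoiders-complete m (0 ∷ unshift (ps ++ v)) lenV (proj₁ V-avoids) (proj₂ V-avoids))
        (∈-map⁺ (1 ∷_) (insertZero-complete ps v ps₀ v₀ v-shape)))
    where
    -- a second 0 would complete 1 0 0
    v₀ : occurs 0 v ≡ false
    v₀ with occurs 0 v in eq
    ... | false = refl
    ... | true  with trans (sym (repeatedBelow-hit 1 ps 0 v refl eq)) (proj₁ (∨-false hz))
    ...   | ()
    v-shape : v ≡ [] ⊎ ∃ λ v′ → v ≡ 1 ∷ v′
    v-shape = starts-with-1 v (catalanTail-suffix 1 ps 0 v cz) v₀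
    ps++v₀ : occurs 0 (ps ++ v) ≡ false
    ps++v₀ = trans (occurs-++ 0 ps v) (cong₂ _∨_ ps₀ v₀)
    lenV : suc (length (unshift (ps ++ v))) ≡ m
    lenV = ℕ.suc-injective (trans (cong (suc ∘ suc) (length-unshift (ps ++ v) ps++v₀))
                                  (trans (cong suc (sym (length-insert ps 0 v))) len))
    V-avoids = unshift-avoider (ps ++ v) ps++v₀ (catalanTail-delete0 1 ps v cz)
                               (trans (sym (has100-delete0 (1 ∷ ps) v ps++v₀)) hz)

shift-injective : ∀ {a b : Word} → shift a ≡ shift b → a ≡ b
shift-injective {a} {b} eq = trans (sym (unshift-shift a)) (trans (cong unshift eq) (unshift-shift b))

insertZero-unique : ∀ ys → Unique (insertZero ys)
insertZero-unique []           = [] ∷ []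
insertZero-unique (zero ∷ ys)  = All.tabulate head≢ ∷ map⁺ ∷-injectiveʳ (insertZero-unique ys)
  where
  head≢ : ∀ {t} → t ∈ map (1 ∷_) (insertZero ys) → 0 ∷ 1 ∷ shift ys ≢ t
  head≢ t∈ with ∈-map⁻ (1 ∷_) t∈
  ... | _ , _ , refl = λ ()
insertZero-unique (suc y ∷ ys) = map⁺ ∷-injectiveʳ (insertZero-unique ys)

insertZero⁺-unique : ∀ V → Unique (insertZero⁺ V)
insertZero⁺-unique []       = []
insertZero⁺-unique (x ∷ xs) = map⁺ ∷-injectiveʳ (insertZero-unique xs)

insertZero⁺-unshift : ∀ V {z} → z ∈ insertZero⁺ V → unshift z ≡ V
insertZero⁺-unshift (x ∷ xs) z∈ with ∈-map⁻ (suc x ∷_) z∈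
... | t , t∈ , refl = cong (x ∷_) (insertZero-unshift xs t∈)

avoiders₁-head : ∀ n {z} → z ∈ avoiders₁ n → ∃₂ λ y t → z ≡ suc y ∷ t
avoiders₁-head (suc m) z∈ with ∈-++⁻ (map shift (avoiders (suc m))) z∈
... | inj₁ z∈shifts with ∈-map⁻ shift z∈shifts
...   | []    , V∈ , refl with avoiders-sound (suc m) V∈
...     | _ , _ , ()
avoiders₁-head (suc m) z∈ | inj₁ _ | x ∷ V , _ , refl = x , shift V , refl
avoiders₁-head (suc m) z∈ | inj₂ z∈ins with ∈-concatMap-find insertZero⁺ (avoiders m) z∈ins
... | x ∷ xs , _ , z∈V with ∈-map⁻ (suc x ∷_) z∈V
...   | t , _ , refl = x , t , refl

mutual
  avoiders-unique : ∀ n → Unique (avoiders n)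
  avoiders-unique zero    = [] ∷ []
  avoiders-unique (suc n) = map⁺ ∷-injectiveʳ (++⁺ (avoiders-unique n) (avoiders₁-unique n) disjoint)
    where
    disjoint : ∀ {z} → ¬ (z ∈ avoiders n × z ∈ avoiders₁ n)
    disjoint {z} (z∈S , z∈U) with avoiders₁-head n z∈U | avoiders-sound n z∈S
    ... | y , t , refl | () , _ , _

  avoiders₁-unique : ∀ n → Unique (avoiders₁ n)
  avoiders₁-unique zero    = []
  avoiders₁-unique (suc m) =
    ++⁺ (map⁺ shift-injective (avoiders-unique (suc m)))
        (Unique-concatMap⁺ insertZero⁺ unshift (avoiders-unique m) insertZero⁺-unique insertZero⁺-unshift)
        disjoint
    where
    -- shifted words have no 0, inserted words have one
    disjoint : ∀ {z} → ¬ (z ∈ map shift (avoiders (suc m)) × z ∈ concatMap insertZero⁺ (avoiders m))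
    disjoint (z∈shifts , z∈ins) with ∈-map⁻ shift z∈shifts | ∈-concatMap-find insertZero⁺ (avoiders m) z∈ins
    ... | V , _ , refl | x ∷ xs , _ , z∈V with ∈-map⁻ (suc x ∷_) z∈V
    ...   | t , t∈ , eq
      with trans (sym (occurs-0-shift V)) (trans (cong (occurs 0) eq) (insertZero-occurs0 xs t∈))
    ... | ()

-- Catalan words

wordsOf-unique : ∀ n b → Unique (wordsOf n b)
wordsOf-unique zero    b = [] ∷ []
wordsOf-unique (suc n) b =
  Unique-concatMap⁺ (λ x → map (x ∷_) (wordsOf n b)) first (upTo⁺ b)
    (λ x → map⁺ ∷-injectiveʳ (wordsOf-unique n b)) first-fibre
  where
  first : Word → ℕ
  first []      = 0
  first (x ∷ _) = x
  first-fibre : ∀ x {w} → w ∈ map (x ∷_) (wordsOf n b) → first w ≡ x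
  first-fibre x w∈ with ∈-map⁻ (x ∷_) w∈
  ... | _ , _ , refl = refl

wordsOf-length : ∀ n b {w} → w ∈ wordsOf n b → length w ≡ n
wordsOf-length zero    b (here refl) = refl
wordsOf-length (suc n) b w∈ with ∈-concatMap-find (λ x → map (x ∷_) (wordsOf n b)) (upTo b) w∈
... | x , _ , w∈x with ∈-map⁻ (x ∷_) w∈x
... | w′ , w′∈ , refl = cong suc (wordsOf-length n b w′∈)

wordsOf-complete : ∀ n b w → length w ≡ n → All (_< b) w → w ∈ wordsOf n b
wordsOf-complete zero    b []      _   _            = here refl
wordsOf-complete (suc n) b (y ∷ w) len (y<b ∷ w<b) =
  ∈-concatMap-lose (λ x → map (x ∷_) (wordsOf n b)) (∈-upTo⁺ y<b)
    (∈-map⁺ (y ∷_) (wordsOf-complete n b w (ℕ.suc-injective len) w<b))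

catalanTail-bound : ∀ p ys → catalanTail p ys ≡ true → All (_< suc p + length ys) ys
catalanTail-bound p []       _  = []
catalanTail-bound p (y ∷ ys) ct with ∧-true {y ≤ᵇ suc p} ct
... | y≤ᵇ , ct′ = y<bound ∷ All.map (λ x< → ℕ.<-≤-trans x< bound-mono) (catalanTail-bound y ys ct′)
  where
  l = length ys
  y≤ : y ≤ suc p
  y≤ = ℕ.≤ᵇ⇒≤ y (suc p) (toT y≤ᵇ)
  bound-eq : suc (suc p) + l ≡ suc p + suc l
  bound-eq = sym (ℕ.+-suc (suc p) l)
  y<bound : y < suc p + suc l
  y<bound = subst (y <_) bound-eq (s≤s (ℕ.≤-trans y≤ (ℕ.m≤m+n (suc p) l)))
  bound-mono : suc y + l ≤ suc p + suc l
  bound-mono = subst (suc y + l ≤_) bound-eq (ℕ.+-monoˡ-≤ l (s≤s y≤))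

catalan-bound : ∀ w → isCatalan w ≡ true → All (_< length w) w
catalan-bound []         _  = []
catalan-bound (zero ∷ w) cw = s≤s z≤n ∷ catalanTail-bound 0 w cw

c-100-avoiders : ∀ n k → c p100 n k ≡ length (filterᵇ (λ w → descents w ≡ᵇ k) (avoiders n))
c-100-avoiders n k = Unique⇒length≡ counted listed
  (filter⁺ (T? ∘ P) (filter⁺ (T? ∘ isCatalan) (wordsOf-unique n n)))
  (filter⁺ (T? ∘ D) (avoiders-unique n))
  counted⊆listed listed⊆counted
  where
  P D : Word → Bool
  P w = avoids w p100 ∧ (descents w ≡ᵇ k)
  D w = descents w ≡ᵇ k
  counted = filterᵇ P (catalanWords n)
  listed  = filterᵇ D (avoiders n)
  avoids⇔has100 : ∀ w → avoids w p100 ≡ not (has100 w)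
  avoids⇔has100 w = cong not (contains-100 w)

  counted⊆listed : ∀ {w} → w ∈ counted → w ∈ listed
  counted⊆listed {w} w∈ with ∈-filter⁻ (T? ∘ P) {xs = catalanWords n} w∈
  ... | w∈C , Pw with ∈-filter⁻ (T? ∘ isCatalan) {xs = wordsOf n n} w∈C | ∧-true {avoids w p100} (fromT Pw)
  ... | w∈W , cw | avw , dw =
    ∈-filter⁺ (T? ∘ D)
      (avoiders-complete n w (wordsOf-length n n w∈W) (fromT cw)
                         (not-injective (trans (sym (avoids⇔has100 w)) avw)))
      (toT dw)

  listed⊆counted : ∀ {w} → w ∈ listed → w ∈ counted
  listed⊆counted {w} w∈ with ∈-filter⁻ (T? ∘ D) {xs = avoiders n} w∈
  ... | w∈S , dw with avoiders-sound n w∈S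
  ... | cw , hw , lw =
    ∈-filter⁺ (T? ∘ P)
      (∈-filter⁺ (T? ∘ isCatalan)
                 (wordsOf-complete n n w lw (subst (λ l → All (_< l) w) lw (catalan-bound w cw))) (toT cw))
      (toT (cong₂ _∧_ (trans (avoids⇔has100 w) (cong not hw)) (fromT dw)))

-- Descents

-- For the slots of insertZero ys, where p is the letter preceding ys: quietAfter p ys counts
-- those whose insertion keeps the number of descents of suc p ∷ shift ys, loudAfter p ys
-- those that add one.
quietAfter : ℕ → Word → ℕ
quietAfter p       []           = 0
quietAfter p       (suc y ∷ ys) = quietAfter (suc y) ys
quietAfter zero    (zero ∷ ys)  = quietAfter 0 ys
quietAfter (suc p) (zero ∷ ys)  = suc (quietAfter 0 ys)

loudAfter : ℕ → Word → ℕ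
loudAfter p       []           = 1
loudAfter p       (suc y ∷ ys) = loudAfter (suc y) ys
loudAfter zero    (zero ∷ ys)  = suc (loudAfter 0 ys)
loudAfter (suc p) (zero ∷ ys)  = loudAfter 0 ys

quietSlots loudSlots : Word → ℕ
quietSlots []       = 0
quietSlots (x ∷ xs) = quietAfter x xs
loudSlots  []       = 0
loudSlots  (x ∷ xs) = loudAfter x xs

descents-shift : ∀ w → descents (shift w) ≡ descents w
descents-shift []           = refl
descents-shift (x ∷ [])     = refl
descents-shift (x ∷ y ∷ ys) = cong (_+_ (if y <ᵇ x then 1 else 0)) (descents-shift (y ∷ ys))

descents-0∷ : ∀ w → descents (0 ∷ w) ≡ descents w
descents-0∷ []      = refl
descents-0∷ (_ ∷ _) = refl

descents-insertZero : ∀ (f : ℕ → ℕ) p ys →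
  total (f ∘ descents ∘ (suc p ∷_)) (insertZero ys)
    ≡ quietAfter p ys * f (descents (p ∷ ys)) + loudAfter p ys * f (suc (descents (p ∷ ys)))
descents-insertZero f p [] = refl
descents-insertZero f zero (zero ∷ ys)
  rewrite descents-shift (0 ∷ ys) | total-map (f ∘ descents ∘ (1 ∷_)) (1 ∷_) (insertZero ys)
        | descents-insertZero f 0 ys =
  rearrange (f (descents (0 ∷ ys))) (f (suc (descents (0 ∷ ys)))) (quietAfter 0 ys) (loudAfter 0 ys)
  where
  rearrange : ∀ a b q l → b + (q * a + l * b) ≡ q * a + (b + l * b)
  rearrange = solve-∀
descents-insertZero f (suc p) (zero ∷ ys)
  rewrite descents-shift (0 ∷ ys) | total-map (f ∘ descents ∘ (suc (suc p) ∷_)) (1 ∷_) (insertZero ys)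
        | descents-insertZero (f ∘ suc) 0 ys =
  rearrange (f (suc (descents (0 ∷ ys)))) (f (suc (suc (descents (0 ∷ ys))))) (quietAfter 0 ys) (loudAfter 0 ys)
  where
  rearrange : ∀ a b q l → a + (q * a + l * b) ≡ (a + q * a) + l * b
  rearrange = solve-∀
descents-insertZero f p (suc y ∷ ys) =
  trans (total-map (f ∘ descents ∘ (suc p ∷_)) (suc (suc y) ∷_) (insertZero ys))
        (trans (descents-insertZero (f ∘ _+_ e) (suc y) ys)
               (cong (λ d → quietAfter (suc y) ys * f (e + D) + loudAfter (suc y) ys * f d) (ℕ.+-suc e D)))
  where
  e = if suc y <ᵇ p then 1 else 0
  D = descents (suc y ∷ ys)

quietAfter-shift : ∀ p ys → quietAfter p (shift ys) ≡ 0
quietAfter-shift p []       = refl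
quietAfter-shift p (y ∷ ys) = quietAfter-shift (suc y) ys

loudAfter-shift : ∀ p ys → loudAfter p (shift ys) ≡ 1
loudAfter-shift p []       = refl
loudAfter-shift p (y ∷ ys) = loudAfter-shift (suc y) ys

quietSlots-0∷ : ∀ w → quietSlots (0 ∷ w) ≡ quietSlots w
quietSlots-0∷ []          = refl
quietSlots-0∷ (zero ∷ w)  = refl
quietSlots-0∷ (suc x ∷ w) = refl

insertZero-slots : ∀ p ys → All (λ t → quietAfter (suc p) t ≡ 1 × loudAfter (suc p) t ≡ 1) (insertZero ys)
insertZero-slots p []           = (refl , refl) ∷ []
insertZero-slots p (zero ∷ ys)  =
  (cong suc (quietAfter-shift 1 ys) , loudAfter-shift 1 ys) ∷ All-map⁺ (insertZero-slots 0 ys)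
insertZero-slots p (suc y ∷ ys) = All-map⁺ (insertZero-slots (suc y) ys)

insertZero⁺-slots : ∀ V → All (λ t → quietSlots t ≡ 1 × loudAfter 0 t ≡ 1) (insertZero⁺ V)
insertZero⁺-slots []       = []
insertZero⁺-slots (x ∷ xs) = All-map⁺ (insertZero-slots x xs)

avoiders₁-loud : ∀ n → All (λ z → loudAfter 0 z ≡ 1) (avoiders₁ n)
avoiders₁-loud zero    = []
avoiders₁-loud (suc m) =
  All-++⁺ (All-map⁺ (All.universal (λ V → loudAfter-shift 0 V) _))
          (All-concat⁺ (All-map⁺ (All.universal (λ V → All.map proj₂ (insertZero⁺-slots V)) (avoiders m))))

avoiders-loud : ∀ n → All (λ w → loudAfter 0 w ≡ suc (loudSlots w)) (avoiders n)
avoiders-loud zero    = refl ∷ []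
avoiders-loud (suc n) = All-map⁺ (All.universal (λ _ → refl) _)

total-insertZero⁺ : ∀ (f : ℕ → ℕ) V →
  total (f ∘ descents) (insertZero⁺ V) ≡ quietSlots V * f (descents V) + loudSlots V * f (suc (descents V))
total-insertZero⁺ f []       = refl
total-insertZero⁺ f (x ∷ xs) =
  trans (total-map (f ∘ descents) (suc x ∷_) (insertZero xs)) (descents-insertZero f x xs)

module _ (f : ℕ → ℕ) where

  Av Av₁ Quiet Loud : ℕ → ℕ
  Av    n = total (f ∘ descents) (avoiders n)
  Av₁   n = total (f ∘ descents) (avoiders₁ n)
  Quiet n = total (λ w → quietSlots w * f (descents w)) (avoiders n)
  Loud  n = total (λ w → loudSlots w * f (descents w)) (avoiders n)

total-insertions : ∀ (f : ℕ → ℕ) m →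
  total (f ∘ descents) (concatMap insertZero⁺ (avoiders m)) ≡ Quiet f m + Loud (f ∘ suc) m
total-insertions f m =
  trans (total-concatMap (f ∘ descents) insertZero⁺ (avoiders m))
        (trans (total-cong (total-insertZero⁺ f) (avoiders m))
               (total-+ (λ V → quietSlots V * f (descents V)) (λ V → loudSlots V * f (suc (descents V)))
                        (avoiders m)))

total-0∷ : ∀ (g : Word → ℕ) n →
  total g (avoiders (suc n)) ≡ total (g ∘ (0 ∷_)) (avoiders n) + total (g ∘ (0 ∷_)) (avoiders₁ n)
total-0∷ g n =
  trans (total-map g (0 ∷_) (avoiders n ++ avoiders₁ n)) (total-++ (g ∘ (0 ∷_)) (avoiders n) (avoiders₁ n))

total-avoiders₁-suc : ∀ (g : Word → ℕ) m → total g (avoiders₁ (suc m))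
  ≡ total (g ∘ shift) (avoiders (suc m)) + total g (concatMap insertZero⁺ (avoiders m))
total-avoiders₁-suc g m =
  trans (total-++ g (map shift (avoiders (suc m))) (concatMap insertZero⁺ (avoiders m)))
        (cong (_+ total g (concatMap insertZero⁺ (avoiders m))) (total-map g shift (avoiders (suc m))))

Av-suc : ∀ f n → Av f (suc n) ≡ Av f n + Av₁ f n
Av-suc f n = trans (total-0∷ (f ∘ descents) n)
  (cong₂ _+_ (total-cong (cong f ∘ descents-0∷) (avoiders n))
             (total-cong (cong f ∘ descents-0∷) (avoiders₁ n)))

Av₁-suc : ∀ f m → Av₁ f (suc m) ≡ Av f (suc m) + (Quiet f m + Loud (f ∘ suc) m)
Av₁-suc f m = trans (total-avoiders₁-suc (f ∘ descents) m)
  (cong₂ _+_ (total-cong (cong f ∘ descents-shift) (avoiders (suc m))) (total-insertions f m))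

Quiet-suc : ∀ f n → Quiet f (suc n) ≡ Quiet f n + total (λ z → quietSlots z * f (descents z)) (avoiders₁ n)
Quiet-suc f n = trans (total-0∷ (λ w → quietSlots w * f (descents w)) n)
                      (cong₂ _+_ (total-cong drop0 (avoiders n)) (total-cong drop0 (avoiders₁ n)))
  where
  drop0 : ∀ z → quietSlots (0 ∷ z) * f (descents (0 ∷ z)) ≡ quietSlots z * f (descents z)
  drop0 z = cong₂ _*_ (quietSlots-0∷ z) (cong f (descents-0∷ z))

Quiet-suc-suc : ∀ f m → Quiet f (suc (suc m)) ≡ Quiet f (suc m) + (Quiet f m + Loud (f ∘ suc) m)
Quiet-suc-suc f m = begin
  Quiet f (2 + m)
    ≡⟨ Quiet-suc f (1 + m) ⟩
  Quiet f (1 + m) + total qd (avoiders₁ (1 + m))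
    ≡⟨ cong (_+_ (Quiet f (1 + m))) (total-avoiders₁-suc qd m) ⟩
  Quiet f (1 + m) + (total (qd ∘ shift) (avoiders (1 + m)) + total qd inserted)
    ≡⟨ cong (_+_ (Quiet f (1 + m))) (cong₂ _+_ shifted inserted-quiet) ⟩
  Quiet f (1 + m) + total (f ∘ descents) inserted
    ≡⟨ cong (_+_ (Quiet f (1 + m))) (total-insertions f m) ⟩
  Quiet f (1 + m) + (Quiet f m + Loud (f ∘ suc) m)
    ∎
  where
  open ≡-Reasoning
  qd : Word → ℕ
  qd z = quietSlots z * f (descents z)
  inserted = concatMap insertZero⁺ (avoiders m)
  shifted : total (qd ∘ shift) (avoiders (1 + m)) ≡ 0
  shifted = trans (total-cong no-quiet-slot (avoiders (1 + m))) (total-zero (avoiders (1 + m)))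
    where
    no-quiet-slot : ∀ V → qd (shift V) ≡ 0
    no-quiet-slot []       = refl
    no-quiet-slot (x ∷ xs) = cong (_* f (descents (shift (x ∷ xs)))) (quietAfter-shift (suc x) xs)
  inserted-quiet : total qd inserted ≡ total (f ∘ descents) inserted
  inserted-quiet = begin
    total qd inserted                                           ≡⟨ total-concatMap qd insertZero⁺ (avoiders m) ⟩
    total (total qd ∘ insertZero⁺) (avoiders m)                 ≡⟨ total-cong one-quiet-slot (avoiders m) ⟩
    total (total (f ∘ descents) ∘ insertZero⁺) (avoiders m)     ≡⟨ total-concatMap (f ∘ descents) insertZero⁺ (avoiders m) ⟨
    total (f ∘ descents) inserted                               ∎
    where
    one-quiet-slot : ∀ V → total qd (insertZero⁺ V) ≡ total (f ∘ descents) (insertZero⁺ V)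
    one-quiet-slot V = total-unit-weight quietSlots (f ∘ descents) (All.map proj₁ (insertZero⁺-slots V))

Loud-suc : ∀ f n → Loud f (suc n) ≡ (Av f n + Loud f n) + Av₁ f n
Loud-suc f n = trans (total-0∷ ld n) (cong₂ _+_ after-avoiders after-avoiders₁)
  where
  ld : Word → ℕ
  ld w = loudSlots w * f (descents w)
  after-avoiders : total (ld ∘ (0 ∷_)) (avoiders n) ≡ Av f n + Loud f n
  after-avoiders =
    trans (total-cong-All (All.map (λ {w} eq → cong₂ _*_ eq (cong f (descents-0∷ w))) (avoiders-loud n)))
          (total-+ (f ∘ descents) ld (avoiders n))
  after-avoiders₁ : total (ld ∘ (0 ∷_)) (avoiders₁ n) ≡ Av₁ f n
  after-avoiders₁ =
    trans (total-cong (λ z → cong (loudAfter 0 z *_) (cong f (descents-0∷ z))) (avoiders₁ n))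
          (total-unit-weight (loudAfter 0) (f ∘ descents) (avoiders₁-loud n))

Av-recurrence : ∀ f m →
  Av f (4 + m) + Av f (2 + m) + 2 * Av f (1 + m) ≡ Av (f ∘ suc) (2 + m) + 3 * Av f (3 + m)
Av-recurrence f m =
  eliminate {a₁ = Av f (1 + m)} {q₀ = Quiet f m} {Quiet f (1 + m)} {l₀ = Loud (f ∘ suc) m} {Loud (f ∘ suc) (1 + m)}
            {a′₁ = Av (f ∘ suc) (1 + m)} {u′₁ = Av₁ (f ∘ suc) (1 + m)}
  (Av₁-suc f m) (Av-suc f (1 + m)) (Av₁-suc f (1 + m)) (Av-suc f (2 + m))
  (Av-suc (f ∘ suc) (1 + m)) (Loud-suc (f ∘ suc) (1 + m)) (Quiet-suc-suc f m)
  (Av₁-suc f (2 + m)) (Av-suc f (3 + m))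
  where
  -- aᵢ, uᵢ, qᵢ, lᵢ: Av, Av₁, Quiet, Loud ∘ suc at length i + m; a′, u′: Av, Av₁ of f ∘ suc.
  eliminate : ∀ {a₁ a₂ a₃ a₄ u₁ u₂ u₃ q₀ q₁ q₂ l₀ l₁ l₂ a′₁ a′₂ u′₁} →
    u₁ ≡ a₁ + (q₀ + l₀) → a₂ ≡ a₁ + u₁ → u₂ ≡ a₂ + (q₁ + l₁) → a₃ ≡ a₂ + u₂ →
    a′₂ ≡ a′₁ + u′₁ → l₂ ≡ (a′₁ + l₁) + u′₁ → q₂ ≡ q₁ + (q₀ + l₀) →
    u₃ ≡ a₃ + (q₂ + l₂) → a₄ ≡ a₃ + u₃ →
    a₄ + a₂ + 2 * a₁ ≡ a′₂ + 3 * a₃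
  eliminate {a₁} {q₀ = q₀} {q₁} {l₀ = l₀} {l₁} {a′₁ = a′₁} {u′₁ = u′₁}
    refl refl refl refl refl refl refl refl refl = solve a₁ q₀ q₁ l₀ l₁ a′₁ u′₁
    where
    solve : ∀ a₁ q₀ q₁ l₀ l₁ a′₁ u′₁ →
      let u₁ = a₁ + (q₀ + l₀) ; a₂ = a₁ + u₁ ; u₂ = a₂ + (q₁ + l₁) ; a₃ = a₂ + u₂
          q₂ = q₁ + (q₀ + l₀) ; l₂ = (a′₁ + l₁) + u′₁ ; u₃ = a₃ + (q₂ + l₂) in
      (a₃ + u₃) + a₂ + 2 * a₁ ≡ (a′₁ + u′₁) + 3 * a₃
    solve = solve-∀

-- The product with the denominator

sumℤ-++ : ∀ xs ys → sumℤ (xs ++ ys) ≡ sumℤ xs +ℤ sumℤ ys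
sumℤ-++ []       ys = sym (ℤ.+-identityˡ (sumℤ ys))
sumℤ-++ (x ∷ xs) ys = trans (cong (x +ℤ_) (sumℤ-++ xs ys)) (sym (ℤ.+-assoc x (sumℤ xs) (sumℤ ys)))

sumℤ-concatMap : (f : A → List ℤ) (xs : List A) → sumℤ (concatMap f xs) ≡ sumℤ (map (sumℤ ∘ f) xs)
sumℤ-concatMap f []       = refl
sumℤ-concatMap f (x ∷ xs) = trans (sumℤ-++ (f x) (concatMap f xs)) (cong (sumℤ (f x) +ℤ_) (sumℤ-concatMap f xs))

sumℤ-upTo-suc : (g : ℕ → ℤ) (n : ℕ) → sumℤ (map g (upTo (suc n))) ≡ sumℤ (map g (upTo n)) +ℤ g n
sumℤ-upTo-suc g n = begin
  sumℤ (map g (upTo (suc n)))            ≡⟨ cong (sumℤ ∘ map g) (upTo-∷ʳ n) ⟨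
  sumℤ (map g (upTo n ++ [ n ]))         ≡⟨ cong sumℤ (map-++ g (upTo n) [ n ]) ⟩
  sumℤ (map g (upTo n) ++ [ g n ])       ≡⟨ sumℤ-++ (map g (upTo n)) [ g n ] ⟩
  sumℤ (map g (upTo n)) +ℤ (g n +ℤ + 0)  ≡⟨ cong (sumℤ (map g (upTo n)) +ℤ_) (ℤ.+-identityʳ (g n)) ⟩
  sumℤ (map g (upTo n)) +ℤ g n           ∎
  where open ≡-Reasoning

sumℤ-upTo-vanishing : (g : ℕ → ℤ) (n : ℕ) → (∀ i → i < n → g i ≡ + 0) → sumℤ (map g (upTo n)) ≡ + 0
sumℤ-upTo-vanishing g zero    _   = refl
sumℤ-upTo-vanishing g (suc n) g≡0 = trans (sumℤ-upTo-suc g n)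
  (cong₂ _+ℤ_ (sumℤ-upTo-vanishing g n (λ i i<n → g≡0 i (ℕ.m<n⇒m<1+n i<n))) (g≡0 n (ℕ.n<1+n n)))

-- below g k is the coefficient of yᵏ in y · g.
below : (ℕ → ℤ) → ℕ → ℤ
below g zero    = + 0
below g (suc j) = g j

denom-high-y : ∀ a j → denom a (2 + j) ≡ + 0
denom-high-y 0 j = refl
denom-high-y 1 j = refl
denom-high-y 2 j = refl
denom-high-y 3 j = refl
denom-high-y (suc (suc (suc (suc a)))) j = refl

stripe : FPS → ℕ → ℕ → ℕ → ℤ
stripe F k a i = F i k *ℤ denom a 0 +ℤ below (F i) k *ℤ denom a 1

stripe-far : ∀ F k a i → stripe F k (4 + a) i ≡ + 0
stripe-far F k a i = cong₂ _+ℤ_ (ℤ.*-zeroʳ (F i k)) (ℤ.*-zeroʳ (below (F i) k))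

denom-column : ∀ (F : FPS) a i k → sumℤ (map (λ j → F i j *ℤ denom a (k ∸ j)) (upTo (suc k))) ≡ stripe F k a i
denom-column F a i zero    = refl
denom-column F a i (suc j) = begin
  sumℤ (map g (upTo (2 + j)))
    ≡⟨ sumℤ-upTo-suc g (suc j) ⟩
  sumℤ (map g (upTo (suc j))) +ℤ g (suc j)
    ≡⟨ cong (_+ℤ g (suc j)) (sumℤ-upTo-suc g j) ⟩
  (sumℤ (map g (upTo j)) +ℤ g j) +ℤ g (suc j)
    ≡⟨ cong (λ s → (s +ℤ g j) +ℤ g (suc j)) (sumℤ-upTo-vanishing g j far) ⟩
  (+ 0 +ℤ g j) +ℤ g (suc j)
    ≡⟨ cong (_+ℤ g (suc j)) (ℤ.+-identityˡ (g j)) ⟩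
  g j +ℤ g (suc j)
    ≡⟨ cong₂ (λ x y → F i j *ℤ denom a x +ℤ F i (suc j) *ℤ denom a y) (ℕ.m+n∸n≡m 1 j) (ℕ.n∸n≡0 j) ⟩
  F i j *ℤ denom a 1 +ℤ F i (suc j) *ℤ denom a 0
    ≡⟨ ℤ.+-comm (F i j *ℤ denom a 1) (F i (suc j) *ℤ denom a 0) ⟩
  F i (suc j) *ℤ denom a 0 +ℤ F i j *ℤ denom a 1
    ∎
  where
  open ≡-Reasoning
  g : ℕ → ℤ
  g j′ = F i j′ *ℤ denom a (suc j ∸ j′)
  far : ∀ j′ → j′ < j → g j′ ≡ + 0
  far j′ j′<j = begin
    F i j′ *ℤ denom a (suc j ∸ j′)       ≡⟨ cong (λ y → F i j′ *ℤ denom a y) (gap j′ j j′<j) ⟩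
    F i j′ *ℤ denom a (2 + (j ∸ suc j′)) ≡⟨ cong (F i j′ *ℤ_) (denom-high-y a (j ∸ suc j′)) ⟩
    F i j′ *ℤ + 0                        ≡⟨ ℤ.*-zeroʳ (F i j′) ⟩
    + 0                                  ∎
    where
    gap : ∀ i j → i < j → suc j ∸ i ≡ 2 + (j ∸ suc i)
    gap zero    (suc j) _         = refl
    gap (suc i) (suc j) (s≤s i<j) = gap i j i<j

⋆-denom : ∀ (F : FPS) n k → (F ⋆ denom) n k ≡ sumℤ (map (λ i → stripe F k (n ∸ i) i) (upTo (suc n)))
⋆-denom F n k =
  trans (sumℤ-concatMap (λ i → map (λ j → F i j *ℤ denom (n ∸ i) (k ∸ j)) (upTo (suc k))) (upTo (suc n)))
        (cong sumℤ (map-cong (λ i → denom-column F (n ∸ i) i k) (upTo (suc n))))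

⋆-denom-last-four : ∀ (F : FPS) m k → (F ⋆ denom) (4 + m) k ≡
  ((stripe F k 3 (1 + m) +ℤ stripe F k 2 (2 + m)) +ℤ stripe F k 1 (3 + m)) +ℤ stripe F k 0 (4 + m)
⋆-denom-last-four F m k = begin
  (F ⋆ denom) (4 + m) k
    ≡⟨ ⋆-denom F (4 + m) k ⟩
  sumℤ (map g (upTo (5 + m)))
    ≡⟨ sumℤ-upTo-suc g (4 + m) ⟩
  sumℤ (map g (upTo (4 + m))) +ℤ g (4 + m)
    ≡⟨ cong (_+ℤ g (4 + m)) (sumℤ-upTo-suc g (3 + m)) ⟩
  (sumℤ (map g (upTo (3 + m))) +ℤ g (3 + m)) +ℤ g (4 + m)
    ≡⟨ cong (λ s → (s +ℤ g (3 + m)) +ℤ g (4 + m)) (sumℤ-upTo-suc g (2 + m)) ⟩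
  ((sumℤ (map g (upTo (2 + m))) +ℤ g (2 + m)) +ℤ g (3 + m)) +ℤ g (4 + m)
    ≡⟨ cong (λ s → ((s +ℤ g (2 + m)) +ℤ g (3 + m)) +ℤ g (4 + m)) (sumℤ-upTo-suc g (1 + m)) ⟩
  (((sumℤ (map g (upTo (1 + m))) +ℤ g (1 + m)) +ℤ g (2 + m)) +ℤ g (3 + m)) +ℤ g (4 + m)
    ≡⟨ cong (λ s → (((s +ℤ g (1 + m)) +ℤ g (2 + m)) +ℤ g (3 + m)) +ℤ g (4 + m))
            (sumℤ-upTo-vanishing g (1 + m) far) ⟩
  (((+ 0 +ℤ g (1 + m)) +ℤ g (2 + m)) +ℤ g (3 + m)) +ℤ g (4 + m)
    ≡⟨ cong (λ s → ((s +ℤ g (2 + m)) +ℤ g (3 + m)) +ℤ g (4 + m)) (ℤ.+-identityˡ (g (1 + m))) ⟩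
  ((g (1 + m) +ℤ g (2 + m)) +ℤ g (3 + m)) +ℤ g (4 + m)
    ≡⟨ cong₄ (λ a b c d → ((stripe F k a (1 + m) +ℤ stripe F k b (2 + m)) +ℤ stripe F k c (3 + m))
                           +ℤ stripe F k d (4 + m))
             (ℕ.m+n∸n≡m 3 m) (ℕ.m+n∸n≡m 2 m) (ℕ.m+n∸n≡m 1 m) (ℕ.n∸n≡0 m) ⟩
  ((stripe F k 3 (1 + m) +ℤ stripe F k 2 (2 + m)) +ℤ stripe F k 1 (3 + m)) +ℤ stripe F k 0 (4 + m)
    ∎
  where
  open ≡-Reasoning
  g : ℕ → ℤ
  g i = stripe F k (4 + m ∸ i) i
  far : ∀ i → i < 1 + m → g i ≡ + 0
  far i (s≤s i≤m) rewrite ℕ.+-∸-assoc 4 i≤m = stripe-far F k (m ∸ i) i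
  cong₄ : ∀ (h : ℕ → ℕ → ℕ → ℕ → ℤ) {a a′ b b′ c c′ d d′} →
          a ≡ a′ → b ≡ b′ → c ≡ c′ → d ≡ d′ → h a b c d ≡ h a′ b′ c′ d′
  cong₄ h refl refl refl refl = refl

𝟙-at : ℕ → ℕ → ℕ
𝟙-at k e = 𝟙 (e ≡ᵇ k)

Cgf-100 : ∀ n k → Cgf p100 n k ≡ + Av (𝟙-at k) n
Cgf-100 n k = cong +_ (trans (c-100-avoiders n k) (sym (total-𝟙 (λ w → descents w ≡ᵇ k) (avoiders n))))

below-Cgf-100 : ∀ n k → below (Cgf p100 n) k ≡ + Av (𝟙-at k ∘ suc) n
below-Cgf-100 n zero    = cong +_ (sym (total-zero (avoiders n)))
below-Cgf-100 n (suc j) = Cgf-100 n j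

stripe-0 : ∀ (F : FPS) k i → stripe F k 0 i ≡ F i k
stripe-0 F k i = trans (cong₂ _+ℤ_ (ℤ.*-identityʳ (F i k)) (ℤ.*-zeroʳ (below (F i) k))) (ℤ.+-identityʳ (F i k))

⋆-denom-peel : ∀ (F : FPS) n k → (F ⋆ denom) n k ≡ sumℤ (map (λ i → stripe F k (n ∸ i) i) (upTo n)) +ℤ F n k
⋆-denom-peel F n k =
  trans (⋆-denom F n k)
        (trans (sumℤ-upTo-suc (λ i → stripe F k (n ∸ i) i) n)
               (cong (sumℤ (map (λ i → stripe F k (n ∸ i) i) (upTo n)) +ℤ_)
                     (trans (cong (λ a → stripe F k a n) (ℕ.n∸n≡0 n)) (stripe-0 F k n))))

low-degree : ∀ n k → n < 4 → (Cgf p100 ⋆ denom) n k ≡ numer n k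
low-degree 0 0             _ = refl
low-degree 1 0             _ = refl
low-degree 2 0             _ = refl
low-degree 3 0             _ = refl
low-degree 0 1             _ = refl
low-degree 1 1             _ = refl
low-degree 2 1             _ = refl
low-degree 3 1             _ = refl
low-degree 0 (suc (suc j)) _ = ⋆-denom-peel (Cgf p100) 0 (2 + j)
low-degree 1 (suc (suc j)) _ = ⋆-denom-peel (Cgf p100) 1 (2 + j)
low-degree 2 (suc (suc j)) _ = ⋆-denom-peel (Cgf p100) 2 (2 + j)
low-degree 3 (suc (suc j)) _ = ⋆-denom-peel (Cgf p100) 3 (2 + j)
low-degree (suc (suc (suc (suc _)))) _ (s≤s (s≤s (s≤s (s≤s ()))))

-- The four stripes of ⋆-denom-last-four, with the coefficients of denom substituted.
recurrence-cancels : ∀ {A₁ A₂ A₃ A₄ B : ℤ} {a₁ a₂ a₃ a₄ b : ℕ} →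
  A₁ ≡ + a₁ → A₂ ≡ + a₂ → A₃ ≡ + a₃ → A₄ ≡ + a₄ → B ≡ + b → a₄ + a₂ + 2 * a₁ ≡ b + 3 * a₃ →
  ∀ (x₁ x₃ x₄ : ℤ) →
  ((A₁ *ℤ + 2 +ℤ x₁ *ℤ + 0) +ℤ (A₂ *ℤ + 1 +ℤ B *ℤ - + 1)) +ℤ (A₃ *ℤ - + 3 +ℤ x₃ *ℤ + 0)
    +ℤ (A₄ *ℤ + 1 +ℤ x₄ *ℤ + 0) ≡ + 0
recurrence-cancels {a₁ = a₁} {a₂} {a₃} {a₄} {b} refl refl refl refl refl rec x₁ x₃ x₄ = begin
  ((+ a₁ *ℤ + 2 +ℤ x₁ *ℤ + 0) +ℤ (+ a₂ *ℤ + 1 +ℤ + b *ℤ - + 1)) +ℤ (+ a₃ *ℤ - + 3 +ℤ x₃ *ℤ + 0)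
    +ℤ (+ a₄ *ℤ + 1 +ℤ x₄ *ℤ + 0)                 ≡⟨ collect (+ a₁) (+ a₂) (+ a₃) (+ a₄) (+ b) x₁ x₃ x₄ ⟩
  (+ a₄ +ℤ + a₂ +ℤ + 2 *ℤ + a₁) -ℤ (+ b +ℤ + 3 *ℤ + a₃) ≡⟨ cong₂ _-ℤ_ (+-lin a₄ a₂ 2 a₁) (+-lin 0 b 3 a₃) ⟨
  + (a₄ + a₂ + 2 * a₁) -ℤ + (b + 3 * a₃)          ≡⟨ cong (λ l → + l -ℤ + (b + 3 * a₃)) rec ⟩
  + (b + 3 * a₃) -ℤ + (b + 3 * a₃)                ≡⟨ ℤ.+-inverseʳ (+ (b + 3 * a₃)) ⟩
  + 0                                               ∎
  where
  open ≡-Reasoning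
  collect : ∀ A₁ A₂ A₃ A₄ B X₁ X₃ X₄ →
    ((A₁ *ℤ + 2 +ℤ X₁ *ℤ + 0) +ℤ (A₂ *ℤ + 1 +ℤ B *ℤ - + 1)) +ℤ (A₃ *ℤ - + 3 +ℤ X₃ *ℤ + 0)
      +ℤ (A₄ *ℤ + 1 +ℤ X₄ *ℤ + 0)
      ≡ (A₄ +ℤ A₂ +ℤ + 2 *ℤ A₁) -ℤ (B +ℤ + 3 *ℤ A₃)
  collect = ℤ-solve-∀
  +-lin : ∀ p q r s → + (p + q + r * s) ≡ + p +ℤ + q +ℤ + r *ℤ + s
  +-lin p q r s = trans (ℤ.pos-+ (p + q) (r * s)) (cong₂ _+ℤ_ (ℤ.pos-+ p q) (ℤ.pos-* r s))

high-degree : ∀ m k → (Cgf p100 ⋆ denom) (4 + m) k ≡ numer (4 + m) k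
high-degree m k = trans (⋆-denom-last-four (Cgf p100) m k)
  (recurrence-cancels (Cgf-100 (1 + m) k) (Cgf-100 (2 + m) k) (Cgf-100 (3 + m) k) (Cgf-100 (4 + m) k)
                      (below-Cgf-100 (2 + m) k) (Av-recurrence (𝟙-at k) m)
                      (below (Cgf p100 (1 + m)) k) (below (Cgf p100 (3 + m)) k) (below (Cgf p100 (4 + m)) k))

theorem11 : ∀ (n k : ℕ) → (Cgf p100 ⋆ denom) n k ≡ numer n k
theorem11 (suc (suc (suc (suc m)))) k = high-degree m k
theorem11 0 k = low-degree 0 k (s≤s z≤n)
theorem11 1 k = low-degree 1 k (s≤s (s≤s z≤n))
theorem11 2 k = low-degree 2 k (s≤s (s≤s (s≤s z≤n)))
theorem11 3 k = low-degree 3 k (s≤s (s≤s (s≤s (s≤s z≤n))))
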